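{- Let $(\mathcal C,\otimes,I)$ be a monoidal category with a reciprocal orthogonality $\perp$. Then for all objects $R,S$ and all $U\subseteq\mathcal C(I,R)$, $V\subseteq\mathcal C(I,S)$: $(U^{\circ\circ}\otimes V^{\circ\circ})^\circ=(U^{\circ\circ}\otimes V)^\circ=(U\otimes V^{\circ\circ})^\circ$.
   Context: A family of relations $\perp_R\subseteq\mathcal C(I,R)\times\mathcal C(R,I)$ is a reciprocal orthogonality if for all $u:I\to R$, $x:S\to I$, $f:R\to S$: $u\perp_Rx\circ f$ iff $f\circ u\perp_Sx$ (such a family satisfies the isomorphism, identity and tensor conditions of an orthogonality). For $U\subseteq\mathcal C(I,R)$, $U^\circ=\{x:R\to I:\forall u\in U,\ u\perp_Rx\}$, and for $X\subseteq\mathcal C(R,I)$, $X^\circ=\{u:I\to R:\forall x\in X,\ u\perp_Rx\}$. For $U\subseteq\mathcal C(I,R)$, $V\subseteq\mathcal C(I,S)$, $U\otimes V=\{u\otimes v:I\cong I\otimes I\to R\otimes S: u\in U,v\in V\}$. -}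

module Defs where

open import Level using (Level; _⊔_) renaming (suc to lsuc)
open import Relation.Binary.PropositionalEquality using (_≡_)
open import Relation.Unary using (Pred)
open import Data.Product using (Σ; _×_; ∃₂)

record MonoidalCategory (o ℓ : Level) : Set (lsuc (o ⊔ ℓ)) where
  infixr 9 _∘_
  infixr 10 _⊗₀_ _⊗₁_
  field
    Obj : Set o
    _⇒_ : Obj → Obj → Set ℓ
    id  : ∀ {A} → A ⇒ A
    _∘_ : ∀ {A B C} → B ⇒ C → A ⇒ B → A ⇒ C
    identityˡ : ∀ {A B} {f : A ⇒ B} → id ∘ f ≡ f
    identityʳ : ∀ {A B} {f : A ⇒ B} → f ∘ id ≡ f
    assoc : ∀ {A B C D} {f : A ⇒ B} {g : B ⇒ C} {h : C ⇒ D} →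
            (h ∘ g) ∘ f ≡ h ∘ (g ∘ f)
    _⊗₀_ : Obj → Obj → Obj
    _⊗₁_ : ∀ {A B C D} → A ⇒ B → C ⇒ D → (A ⊗₀ C) ⇒ (B ⊗₀ D)
    ⊗-identity : ∀ {A B} → (id {A} ⊗₁ id {B}) ≡ id
    ⊗-homomorphism : ∀ {A B C D E F} {f : A ⇒ B} {g : B ⇒ C} {h : D ⇒ E} {k : E ⇒ F} →
                     ((g ∘ f) ⊗₁ (k ∘ h)) ≡ (g ⊗₁ k) ∘ (f ⊗₁ h)
    I : Obj
    λ⇒ : ∀ {A} → (I ⊗₀ A) ⇒ A
    λ⇐ : ∀ {A} → A ⇒ (I ⊗₀ A)
    λ-isoˡ : ∀ {A} → λ⇐ {A} ∘ λ⇒ ≡ id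
    λ-isoʳ : ∀ {A} → λ⇒ {A} ∘ λ⇐ ≡ id
    λ-natural : ∀ {A B} {f : A ⇒ B} → f ∘ λ⇒ ≡ λ⇒ ∘ (id ⊗₁ f)
    ρ⇒ : ∀ {A} → (A ⊗₀ I) ⇒ A
    ρ⇐ : ∀ {A} → A ⇒ (A ⊗₀ I)
    ρ-isoˡ : ∀ {A} → ρ⇐ {A} ∘ ρ⇒ ≡ id
    ρ-isoʳ : ∀ {A} → ρ⇒ {A} ∘ ρ⇐ ≡ id
    ρ-natural : ∀ {A B} {f : A ⇒ B} → f ∘ ρ⇒ ≡ ρ⇒ ∘ (f ⊗₁ id)
    α⇒ : ∀ {A B C} → ((A ⊗₀ B) ⊗₀ C) ⇒ (A ⊗₀ (B ⊗₀ C))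
    α⇐ : ∀ {A B C} → (A ⊗₀ (B ⊗₀ C)) ⇒ ((A ⊗₀ B) ⊗₀ C)
    α-isoˡ : ∀ {A B C} → α⇐ {A} {B} {C} ∘ α⇒ ≡ id
    α-isoʳ : ∀ {A B C} → α⇒ {A} {B} {C} ∘ α⇐ ≡ id
    α-natural : ∀ {A A' B B' C C'} {f : A ⇒ A'} {g : B ⇒ B'} {h : C ⇒ C'} →
                (f ⊗₁ (g ⊗₁ h)) ∘ α⇒ ≡ α⇒ ∘ ((f ⊗₁ g) ⊗₁ h)
    triangle : ∀ {A B} → (id {A} ⊗₁ λ⇒ {B}) ∘ α⇒ ≡ ρ⇒ ⊗₁ id
    pentagon : ∀ {A B C D} →
               (id {A} ⊗₁ α⇒ {B} {C} {D}) ∘ α⇒ ∘ (α⇒ ⊗₁ id) ≡ α⇒ ∘ α⇒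

module _ {o ℓ : Level} (𝒞 : MonoidalCategory o ℓ) where
  open MonoidalCategory 𝒞

  OrthRel : Set (o ⊔ Level.suc ℓ)
  OrthRel = ∀ {R} → I ⇒ R → R ⇒ I → Set ℓ

  record IsReciprocal (⊥ : OrthRel) : Set (o ⊔ ℓ) where
    field
      reciprocal : ∀ {R S} (u : I ⇒ R) (x : S ⇒ I) (f : R ⇒ S) →
                   (⊥ u (x ∘ f) → ⊥ (f ∘ u) x) × (⊥ (f ∘ u) x → ⊥ u (x ∘ f))

  orthₚ : (⊥ : OrthRel) → ∀ {R} → Pred (I ⇒ R) ℓ → Pred (R ⇒ I) ℓ
  orthₚ ⊥ U x = ∀ u → U u → ⊥ u x

  orthₓ : (⊥ : OrthRel) → ∀ {R} → Pred (R ⇒ I) ℓ → Pred (I ⇒ R) ℓ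
  orthₓ ⊥ X u = ∀ x → X x → ⊥ u x

  _⊗ₛ_ : ∀ {R S} → Pred (I ⇒ R) ℓ → Pred (I ⇒ S) ℓ → Pred (I ⇒ (R ⊗₀ S)) ℓ
  (U ⊗ₛ V) w = ∃₂ λ u v → U u × V v × (w ≡ (u ⊗₁ v) ∘ λ⇐)

{-# OPTIONS --safe #-}
module Submission where

-- Reciprocity says that x is orthogonal to f ∘ b exactly when x ∘ f is orthogonal to b, so
-- orthogonality to an image f[B] depends only on B°, and hence x ⊥ f[B] implies x ⊥ f[B°°].
-- An element (u ⊗ v) ∘ λ⁻¹ of U ⊗ V is the image of v under a map determined by u, and
-- (using Kelly's coherence λ_I = ρ_I) also the image of u under a map determined by v.
-- So either factor of (U ⊗ V)° may be replaced by its biorthogonal closure, and the three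
-- sets in the statement all coincide with (U°° ⊗ V°°)°.

open import Defs
open import Level using (Level)
open import Relation.Unary using (Pred; _≐_; _⊆_)
open import Data.Product using (_×_; _,_; proj₁; proj₂)
open import Relation.Binary.PropositionalEquality
  using (_≡_; refl; sym; trans; cong; cong₂; subst; module ≡-Reasoning)
open MonoidalCategory using (Obj; _⇒_; I)

module MonoidalProperties {o ℓ : Level} (𝒞 : MonoidalCategory o ℓ) where
  open MonoidalCategory 𝒞 hiding (Obj; _⇒_; I; _⊗₀_)
  open MonoidalCategory 𝒞 using () renaming (_⇒_ to _⟶_; I to 𝟙; _⊗₀_ to _⊗_)
  open ≡-Reasoning

  cancelˡ : ∀ {A B C} {h : B ⟶ C} (h⁻¹ : C ⟶ B) → h⁻¹ ∘ h ≡ id →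
            {f g : A ⟶ B} → h ∘ f ≡ h ∘ g → f ≡ g
  cancelˡ {h = h} h⁻¹ inv {f} {g} eq = begin
    f              ≡⟨ sym identityˡ ⟩
    id ∘ f         ≡⟨ cong (_∘ f) (sym inv) ⟩
    (h⁻¹ ∘ h) ∘ f  ≡⟨ assoc ⟩
    h⁻¹ ∘ (h ∘ f)  ≡⟨ cong (h⁻¹ ∘_) eq ⟩
    h⁻¹ ∘ (h ∘ g)  ≡⟨ sym assoc ⟩
    (h⁻¹ ∘ h) ∘ g  ≡⟨ cong (_∘ g) inv ⟩
    id ∘ g         ≡⟨ identityˡ ⟩
    g              ∎

  cancelʳ : ∀ {A B C} {k : A ⟶ B} (k⁻¹ : B ⟶ A) → k ∘ k⁻¹ ≡ id →
            {f g : B ⟶ C} → f ∘ k ≡ g ∘ k → f ≡ g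
  cancelʳ {k = k} k⁻¹ inv {f} {g} eq = begin
    f              ≡⟨ sym identityʳ ⟩
    f ∘ id         ≡⟨ cong (f ∘_) (sym inv) ⟩
    f ∘ (k ∘ k⁻¹)  ≡⟨ sym assoc ⟩
    (f ∘ k) ∘ k⁻¹  ≡⟨ cong (_∘ k⁻¹) eq ⟩
    (g ∘ k) ∘ k⁻¹  ≡⟨ assoc ⟩
    g ∘ (k ∘ k⁻¹)  ≡⟨ cong (g ∘_) inv ⟩
    g ∘ id         ≡⟨ identityʳ ⟩
    g              ∎

  inverse-natural : ∀ {A B C D} {a : A ⟶ B} {a⁻¹ : B ⟶ A} {b : C ⟶ D} {b⁻¹ : D ⟶ C}
                    {f : B ⟶ D} {g : A ⟶ C} →
                    a ∘ a⁻¹ ≡ id → b⁻¹ ∘ b ≡ id → f ∘ a ≡ b ∘ g → b⁻¹ ∘ f ≡ g ∘ a⁻¹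
  inverse-natural {a = a} {a⁻¹} {b} {b⁻¹} {f} {g} a-inv b-inv nat = begin
    b⁻¹ ∘ f                ≡⟨ cong (b⁻¹ ∘_) (sym identityʳ) ⟩
    b⁻¹ ∘ (f ∘ id)         ≡⟨ cong (λ z → b⁻¹ ∘ (f ∘ z)) (sym a-inv) ⟩
    b⁻¹ ∘ (f ∘ (a ∘ a⁻¹))  ≡⟨ cong (b⁻¹ ∘_) (sym assoc) ⟩
    b⁻¹ ∘ ((f ∘ a) ∘ a⁻¹)  ≡⟨ cong (λ z → b⁻¹ ∘ (z ∘ a⁻¹)) nat ⟩
    b⁻¹ ∘ ((b ∘ g) ∘ a⁻¹)  ≡⟨ cong (b⁻¹ ∘_) assoc ⟩
    b⁻¹ ∘ (b ∘ (g ∘ a⁻¹))  ≡⟨ sym assoc ⟩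
    (b⁻¹ ∘ b) ∘ (g ∘ a⁻¹)  ≡⟨ cong (_∘ (g ∘ a⁻¹)) b-inv ⟩
    id ∘ (g ∘ a⁻¹)         ≡⟨ identityˡ ⟩
    g ∘ a⁻¹                ∎

  λ⇐-natural : ∀ {A B} {f : A ⟶ B} → λ⇐ ∘ f ≡ (id ⊗₁ f) ∘ λ⇐
  λ⇐-natural = inverse-natural λ-isoʳ λ-isoˡ λ-natural

  ρ⇐-natural : ∀ {A B} {f : A ⟶ B} → ρ⇐ ∘ f ≡ (f ⊗₁ id) ∘ ρ⇐
  ρ⇐-natural = inverse-natural ρ-isoʳ ρ-isoˡ ρ-natural

  id⊗-injective : ∀ {A B} {f g : A ⟶ B} → id {𝟙} ⊗₁ f ≡ id ⊗₁ g → f ≡ g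
  id⊗-injective eq =
    cancelˡ λ⇒ λ-isoʳ (trans λ⇐-natural (trans (cong (_∘ λ⇐) eq) (sym λ⇐-natural)))

  ⊗id-injective : ∀ {A B} {f g : A ⟶ B} → f ⊗₁ id {𝟙} ≡ g ⊗₁ id → f ≡ g
  ⊗id-injective eq =
    cancelˡ ρ⇒ ρ-isoʳ (trans ρ⇐-natural (trans (cong (_∘ ρ⇐) eq) (sym ρ⇐-natural)))

  ⊗-factorˡ : ∀ {A B C D} {f : A ⟶ B} {g : C ⟶ D} → f ⊗₁ g ≡ (f ⊗₁ id) ∘ (id ⊗₁ g)
  ⊗-factorˡ = trans (cong₂ _⊗₁_ (sym identityʳ) (sym identityˡ)) ⊗-homomorphism

  ⊗-factorʳ : ∀ {A B C D} {f : A ⟶ B} {g : C ⟶ D} → f ⊗₁ g ≡ (id ⊗₁ g) ∘ (f ⊗₁ id)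
  ⊗-factorʳ = trans (cong₂ _⊗₁_ (sym identityˡ) (sym identityʳ)) ⊗-homomorphism

  id⊗-distrib-∘ : ∀ {A B C D} {f : B ⟶ C} {g : C ⟶ D} →
                  id {A} ⊗₁ (g ∘ f) ≡ (id ⊗₁ g) ∘ (id ⊗₁ f)
  id⊗-distrib-∘ = trans (cong (_⊗₁ _) (sym identityˡ)) ⊗-homomorphism

  ⊗id-distrib-∘ : ∀ {A B C D} {f : B ⟶ C} {g : C ⟶ D} →
                  (g ∘ f) ⊗₁ id {A} ≡ (g ⊗₁ id) ∘ (f ⊗₁ id)
  ⊗id-distrib-∘ = trans (cong (_ ⊗₁_) (sym identityˡ)) ⊗-homomorphism

  ⊗id-inverse : ∀ {A B C} {f : B ⟶ C} {g : C ⟶ B} → f ∘ g ≡ id → (f ⊗₁ id {A}) ∘ (g ⊗₁ id) ≡ id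
  ⊗id-inverse inv = trans (sym ⊗id-distrib-∘) (trans (cong (_⊗₁ id) inv) ⊗-identity)

  λ⇒-𝟙⊗ : ∀ {A} → λ⇒ {𝟙 ⊗ A} ≡ id ⊗₁ λ⇒
  λ⇒-𝟙⊗ = cancelˡ λ⇐ λ-isoˡ λ-natural

  λ⇒∘α⇒ : ∀ {A B} → λ⇒ {A ⊗ B} ∘ α⇒ {𝟙} ≡ λ⇒ ⊗₁ id
  λ⇒∘α⇒ = id⊗-injective (cancelʳ α⇐ α-isoʳ (cancelʳ (α⇐ ⊗₁ id) (⊗id-inverse α-isoʳ) pentagon-triangle))
    where
    pentagon-triangle : ((id ⊗₁ (λ⇒ ∘ α⇒)) ∘ α⇒) ∘ (α⇒ ⊗₁ id)
                      ≡ ((id ⊗₁ (λ⇒ ⊗₁ id)) ∘ α⇒) ∘ (α⇒ ⊗₁ id)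
    pentagon-triangle = begin
      ((id ⊗₁ (λ⇒ ∘ α⇒)) ∘ α⇒) ∘ (α⇒ ⊗₁ id)        ≡⟨ cong (λ z → (z ∘ α⇒) ∘ (α⇒ ⊗₁ id)) id⊗-distrib-∘ ⟩
      (((id ⊗₁ λ⇒) ∘ (id ⊗₁ α⇒)) ∘ α⇒) ∘ (α⇒ ⊗₁ id) ≡⟨ trans assoc (trans assoc (cong ((id ⊗₁ λ⇒) ∘_) (sym assoc))) ⟩
      (id ⊗₁ λ⇒) ∘ (((id ⊗₁ α⇒) ∘ α⇒) ∘ (α⇒ ⊗₁ id)) ≡⟨ cong ((id ⊗₁ λ⇒) ∘_) (trans assoc pentagon) ⟩
      (id ⊗₁ λ⇒) ∘ (α⇒ ∘ α⇒)                        ≡⟨ trans (sym assoc) (cong (_∘ α⇒) triangle) ⟩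
      (ρ⇒ ⊗₁ id) ∘ α⇒                               ≡⟨ cong (λ z → (ρ⇒ ⊗₁ z) ∘ α⇒) (sym ⊗-identity) ⟩
      (ρ⇒ ⊗₁ (id ⊗₁ id)) ∘ α⇒                       ≡⟨ α-natural ⟩
      α⇒ ∘ ((ρ⇒ ⊗₁ id) ⊗₁ id)                       ≡⟨ cong (λ z → α⇒ ∘ (z ⊗₁ id)) (sym triangle) ⟩
      α⇒ ∘ (((id ⊗₁ λ⇒) ∘ α⇒) ⊗₁ id)                ≡⟨ cong (α⇒ ∘_) ⊗id-distrib-∘ ⟩
      α⇒ ∘ (((id ⊗₁ λ⇒) ⊗₁ id) ∘ (α⇒ ⊗₁ id))        ≡⟨ sym assoc ⟩
      (α⇒ ∘ ((id ⊗₁ λ⇒) ⊗₁ id)) ∘ (α⇒ ⊗₁ id)        ≡⟨ cong (_∘ (α⇒ ⊗₁ id)) (sym α-natural) ⟩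
      ((id ⊗₁ (λ⇒ ⊗₁ id)) ∘ α⇒) ∘ (α⇒ ⊗₁ id)        ∎

  λ⇒≡ρ⇒ : λ⇒ {𝟙} ≡ ρ⇒
  λ⇒≡ρ⇒ = ⊗id-injective (begin
    λ⇒ ⊗₁ id         ≡⟨ sym λ⇒∘α⇒ ⟩
    λ⇒ ∘ α⇒          ≡⟨ cong (_∘ α⇒) λ⇒-𝟙⊗ ⟩
    (id ⊗₁ λ⇒) ∘ α⇒  ≡⟨ triangle ⟩
    ρ⇒ ⊗₁ id         ∎)

  λ⇐≡ρ⇐ : λ⇐ {𝟙} ≡ ρ⇐
  λ⇐≡ρ⇐ = cancelˡ λ⇐ λ-isoˡ (trans λ-isoʳ (sym (trans (cong (_∘ ρ⇐) λ⇒≡ρ⇒) ρ-isoʳ)))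

  ⊗-factor-through-second : ∀ {R S} (u : 𝟙 ⟶ R) (v : 𝟙 ⟶ S) →
                            (u ⊗₁ v) ∘ λ⇐ ≡ ((u ⊗₁ id) ∘ λ⇐) ∘ v
  ⊗-factor-through-second u v = begin
    (u ⊗₁ v) ∘ λ⇐                  ≡⟨ cong (_∘ λ⇐) ⊗-factorˡ ⟩
    ((u ⊗₁ id) ∘ (id ⊗₁ v)) ∘ λ⇐   ≡⟨ assoc ⟩
    (u ⊗₁ id) ∘ ((id ⊗₁ v) ∘ λ⇐)   ≡⟨ cong ((u ⊗₁ id) ∘_) (sym λ⇐-natural) ⟩
    (u ⊗₁ id) ∘ (λ⇐ ∘ v)           ≡⟨ sym assoc ⟩
    ((u ⊗₁ id) ∘ λ⇐) ∘ v           ∎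

  ⊗-factor-through-first : ∀ {R S} (u : 𝟙 ⟶ R) (v : 𝟙 ⟶ S) →
                           (u ⊗₁ v) ∘ λ⇐ ≡ ((id ⊗₁ v) ∘ ρ⇐) ∘ u
  ⊗-factor-through-first u v = begin
    (u ⊗₁ v) ∘ λ⇐                  ≡⟨ cong (_∘ λ⇐) ⊗-factorʳ ⟩
    ((id ⊗₁ v) ∘ (u ⊗₁ id)) ∘ λ⇐   ≡⟨ assoc ⟩
    (id ⊗₁ v) ∘ ((u ⊗₁ id) ∘ λ⇐)   ≡⟨ cong (λ z → (id ⊗₁ v) ∘ ((u ⊗₁ id) ∘ z)) λ⇐≡ρ⇐ ⟩
    (id ⊗₁ v) ∘ ((u ⊗₁ id) ∘ ρ⇐)   ≡⟨ cong ((id ⊗₁ v) ∘_) (sym ρ⇐-natural) ⟩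
    (id ⊗₁ v) ∘ (ρ⇐ ∘ u)           ≡⟨ sym assoc ⟩
    ((id ⊗₁ v) ∘ ρ⇐) ∘ u           ∎

module ReciprocalOrthogonality {o ℓ : Level} (𝒞 : MonoidalCategory o ℓ)
                               (⊥ : OrthRel 𝒞) (reciprocity : IsReciprocal 𝒞 ⊥) where
  open MonoidalCategory 𝒞 using (id; _∘_; _⊗₀_; _⊗₁_; λ⇐; ρ⇐) renaming (_⇒_ to _⟶_; I to 𝟙)
  open MonoidalProperties 𝒞
  open IsReciprocal reciprocity

  _° : ∀ {R} → Pred (𝟙 ⟶ R) ℓ → Pred (R ⟶ 𝟙) ℓ
  _° = orthₚ 𝒞 ⊥

  _ᵒ : ∀ {R} → Pred (R ⟶ 𝟙) ℓ → Pred (𝟙 ⟶ R) ℓ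
  _ᵒ = orthₓ 𝒞 ⊥

  _⊠_ : ∀ {R S} → Pred (𝟙 ⟶ R) ℓ → Pred (𝟙 ⟶ S) ℓ → Pred (𝟙 ⟶ (R ⊗₀ S)) ℓ
  _⊠_ = _⊗ₛ_ 𝒞

  ⊆-biorth : ∀ {R} (A : Pred (𝟙 ⟶ R) ℓ) → A ⊆ (A °) ᵒ
  ⊆-biorth A a x x∈A° = x∈A° _ a

  ⊠-orth-antitone : ∀ {R S} {A A' : Pred (𝟙 ⟶ R) ℓ} {B B' : Pred (𝟙 ⟶ S) ℓ} →
                    A ⊆ A' → B ⊆ B' → (A' ⊠ B') ° ⊆ (A ⊠ B) °
  ⊠-orth-antitone A⊆A' B⊆B' x∈° w (u , v , a , b , w≡) = x∈° w (u , v , A⊆A' a , B⊆B' b , w≡)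

  orth-image-biorth : ∀ {R S} {B : Pred (𝟙 ⟶ R) ℓ} (f : R ⟶ S) {x : S ⟶ 𝟙} →
                      (∀ b → B b → ⊥ (f ∘ b) x) → ∀ v → ((B °) ᵒ) v → ⊥ (f ∘ v) x
  orth-image-biorth f {x} x⊥fB v v∈B°° =
    proj₁ (reciprocal v x f) (v∈B°° (x ∘ f) λ b b∈B → proj₂ (reciprocal b x f) (x⊥fB b b∈B))

  orth-⊠-closeʳ : ∀ {R S} (A : Pred (𝟙 ⟶ R) ℓ) (B : Pred (𝟙 ⟶ S) ℓ) →
                  (A ⊠ B) ° ⊆ (A ⊠ ((B °) ᵒ)) °
  orth-⊠-closeʳ A B {x} x∈° _ (u , v , a , v∈B°° , refl) =
    subst (λ w → ⊥ w x) (sym (⊗-factor-through-second u v))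
      (orth-image-biorth F x⊥FB v v∈B°°)
    where
    F = (u ⊗₁ id) ∘ λ⇐
    x⊥FB : ∀ b → B b → ⊥ (F ∘ b) x
    x⊥FB b b∈B = subst (λ w → ⊥ w x) (⊗-factor-through-second u b) (x∈° _ (u , b , a , b∈B , refl))

  orth-⊠-closeˡ : ∀ {R S} (A : Pred (𝟙 ⟶ R) ℓ) (B : Pred (𝟙 ⟶ S) ℓ) →
                  (A ⊠ B) ° ⊆ (((A °) ᵒ) ⊠ B) °
  orth-⊠-closeˡ A B {x} x∈° _ (u , v , u∈A°° , b , refl) =
    subst (λ w → ⊥ w x) (sym (⊗-factor-through-first u v))
      (orth-image-biorth G x⊥GA u u∈A°°)
    where
    G = (id ⊗₁ v) ∘ ρ⇐
    x⊥GA : ∀ a → A a → ⊥ (G ∘ a) x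
    x⊥GA a a∈A = subst (λ w → ⊥ w x) (⊗-factor-through-first a v) (x∈° _ (a , v , a∈A , b , refl))

lemma4p22 : {o ℓ : Level} (𝒞 : MonoidalCategory o ℓ) (⊥ : OrthRel 𝒞) → IsReciprocal 𝒞 ⊥ →
    (R S : Obj 𝒞) (U : Pred (_⇒_ 𝒞 (I 𝒞) R) ℓ) (V : Pred (_⇒_ 𝒞 (I 𝒞) S) ℓ) →
      (orthₚ 𝒞 ⊥ (_⊗ₛ_ 𝒞 (orthₓ 𝒞 ⊥ (orthₚ 𝒞 ⊥ U)) (orthₓ 𝒞 ⊥ (orthₚ 𝒞 ⊥ V)))
        ≐ orthₚ 𝒞 ⊥ (_⊗ₛ_ 𝒞 (orthₓ 𝒞 ⊥ (orthₚ 𝒞 ⊥ U)) V))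
      × (orthₚ 𝒞 ⊥ (_⊗ₛ_ 𝒞 (orthₓ 𝒞 ⊥ (orthₚ 𝒞 ⊥ U)) V)
        ≐ orthₚ 𝒞 ⊥ (_⊗ₛ_ 𝒞 U (orthₓ 𝒞 ⊥ (orthₚ 𝒞 ⊥ V))))
lemma4p22 𝒞 ⊥ reciprocity R S U V =
    (shrink-V , orth-⊠-closeʳ U°° V)
  , (λ x∈° → ⊠-orth-antitone (⊆-biorth U) (λ b → b) (orth-⊠-closeʳ U°° V x∈°))
  , (λ x∈° → shrink-V (orth-⊠-closeˡ U V°° x∈°))
  where
  open ReciprocalOrthogonality 𝒞 ⊥ reciprocity
  U°° = (U °) ᵒ
  V°° = (V °) ᵒ
  shrink-V = ⊠-orth-antitone (λ a → a) (⊆-biorth V)
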